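{- Let $t$ be a positive integer, let $\mathcal A\in I(n,t)$ be maximal, fixed and compressed, and let $g$ be any generating set of $\mathcal A$. Then: (1) $\mathscr L_*(g)\in G(\mathcal A)$; (2) $s^+(\mathscr L_*(g))\le s^+(g)$; (3) for any set $B\in\mathscr L(g)$ (i.e. any set obtainable by left shifting a set in $g$), either $B$ or a proper subset of $B$ is in $\mathscr L_*(g)$.
   Context: $S_n$ is the symmetric group on $[n]=\{1,\dots,n\}$; $\mathrm{fix}(\sigma)=\{x:\sigma(x)=x\}$. Two permutations have a cycle in common if that cycle appears in both cycle decompositions (1-cycles count). $\mathcal A\subseteq S_n$ is $t$-cycle-intersecting if any two distinct members have at least $t$ common cycles; $I(n,t)$ is the collection of all such families; $\mathcal A\in I(n,t)$ is maximal if no $\sigma\notin\mathcal A$ can be added keeping the property. Fixing: for $i\ne j$, ${}_{[ij]}\sigma=\sigma$ if $\sigma(i)\ne j$; if $\sigma(i)=j$, ${}_{[ij]}\sigma(i)=i$, ${}_{[ij]}\sigma(\sigma^{ -1}(i))=j$, ${}_{[ij]}\sigma(x)=\sigma(x)$ otherwise; $\triangleleft_{ij}(\mathcal A)=\{\triangleleft_{ij}(\sigma):\sigma\in\mathcal A\}$ with $\triangleleft_{ij}(\sigma)={}_{[ij]}\sigma$ if ${}_{[ij]}\sigma\notin\mathcal A$, else $\sigma$; $\mathcal A$ is fixed if $\triangleleft_{ij}(\mathcal A)=\mathcal A$ for all $i\ne j$. Compression: for $i<j$, $\sigma_{i,j}=\sigma$ if $\sigma(i)=i$ or $\sigma(j)\ne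 j$; otherwise $\sigma_{i,j}(i)=i$, $\sigma_{i,j}(j)=\sigma(i)$, $\sigma_{i,j}(\sigma^{ -1}(i))=j$, $\sigma_{i,j}(y)=\sigma(y)$ otherwise; $\mathcal C_{i,j}(\mathcal A)=\{\mathcal C_{i,j}(\sigma):\sigma\in\mathcal A\}$ with $\mathcal C_{i,j}(\sigma)=\sigma_{i,j}$ if $\sigma_{i,j}\notin\mathcal A$, else $\sigma$; $\mathcal A$ is compressed if $\mathcal C_{i,j}(\mathcal A)=\mathcal A$ for all $i<j$. $\mathscr U_p(B)=\{\sigma: B\subseteq\mathrm{fix}(\sigma)\}$, $\mathscr U_p(\mathcal B)=\bigcup_{B\in\mathcal B}\mathscr U_p(B)$; a generating set for $\mathcal A$ is a collection $g$ of subsets of $[n]$ with no set of size $n-1$ and $\mathscr U_p(g)=\mathcal A$; $G(\mathcal A)$ is the set of generating sets. For $B=\{b_1<\dots<b_k\}$, $\mathscr L(B)=\{\{a_1<\dots<a_k\}\subseteq[n]: a_i\le b_i\ \forall i\}$; $\mathscr L(g)=\bigcup_{B\in g}\mathscr L(B)$; $\mathscr L_*(g)$ is the set of inclusion-minimal elements of $\mathscr L(g)$. $s^+(B)$ is the largest element of $B$ and $s^+(g)=\max_{B\in g}s^+(B)$. -}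

module Defs where

open import Data.Bool using (Bool; true; false; _∧_; _∨_; not; if_then_else_)
open import Data.Nat as ℕ using (ℕ; zero; suc; _⊔_; _+_)
open import Data.Fin as F using (Fin; toℕ)
open import Data.Fin.Subset using (Subset; inside; outside; _⊆_)
open import Data.Vec using (Vec; []; _∷_; lookup; tabulate)
open import Data.Vec.Properties using (≡-dec)
open import Data.List as L using (List; []; _∷_; allFin)
open import Data.Product using (Σ; ∃; _×_; _,_)
open import Relation.Nullary using (¬_; does)
open import Relation.Binary.PropositionalEquality using (_≡_; _≢_)

-- Permutations of [n] are encoded by 0-indexed words  σ = (σ(0),…,σ(n-1)).
-- A family of permutations / collection of subsets of [n] is given by its
-- (Bool-valued) characteristic function.

Word : ℕ → Set
Word n = Vec (Fin n) n

app : ∀ {n} → Word n → Fin n → Fin n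
app σ x = lookup σ x

IsPerm : ∀ {n} → Word n → Set
IsPerm σ = ∀ x y → app σ x ≡ app σ y → x ≡ y

PermFam : ℕ → Set
PermFam n = Word n → Bool

_∈ᶠ_ : ∀ {n} → Word n → PermFam n → Set
σ ∈ᶠ A = A σ ≡ true

eqF : ∀ {n} → Fin n → Fin n → Bool
eqF x y = does (x F.≟ y)

leF : ∀ {n} → Fin n → Fin n → Bool
leF x y = does (x F.≤? y)

allᵇ : ∀ {A : Set} → (A → Bool) → List A → Bool
allᵇ p xs = L.foldr (λ x b → p x ∧ b) true xs

anyᵇ : ∀ {A : Set} → (A → Bool) → List A → Bool
anyᵇ p xs = L.foldr (λ x b → p x ∨ b) false xs

countᵇ : ∀ {A : Set} → (A → Bool) → List A → ℕ
countᵇ p xs = L.length (L.filter (λ x → Data.Bool.T? (p x)) xs)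
  where import Data.Bool

-- A cycle of σ is σ
-- restricted to one of its orbits; it is a cycle of τ as well iff σ and τ
-- agree on that orbit.  Each orbit is counted once, via its least element.

iter : ∀ {n} → Word n → ℕ → Fin n → Fin n
iter σ zero    x = x
iter σ (suc k) x = app σ (iter σ k x)

orbitPts : ∀ {n} → Word n → Fin n → List (Fin n)
orbitPts {n} σ x = L.map (λ k → iter σ (toℕ k) x) (allFin n)

isOrbitMin : ∀ {n} → Word n → Fin n → Bool
isOrbitMin σ x = allᵇ (λ y → leF x y) (orbitPts σ x)

cycleShared : ∀ {n} → Word n → Word n → Fin n → Bool
cycleShared σ τ x = allᵇ (λ y → eqF (app σ y) (app τ y)) (orbitPts σ x)

-- number of cycles (including 1-cycles) common to σ and τ
commonCycles : ∀ {n} → Word n → Word n → ℕ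
commonCycles {n} σ τ =
  countᵇ (λ x → isOrbitMin σ x ∧ cycleShared σ τ x) (allFin n)

CycleIntersecting : ∀ {n} → ℕ → PermFam n → Set
CycleIntersecting t A =
  ∀ σ τ → σ ∈ᶠ A → τ ∈ᶠ A → σ ≢ τ → t ℕ.≤ commonCycles σ τ

InI : (n t : ℕ) → PermFam n → Set
InI n t A = (∀ σ → σ ∈ᶠ A → IsPerm σ) × CycleIntersecting t A

insertF : ∀ {n} → Word n → PermFam n → PermFam n
insertF σ A τ = A τ ∨ does (≡-dec F._≟_ τ σ)

Maximal : (n t : ℕ) → PermFam n → Set
Maximal n t A =
  ∀ σ → IsPerm σ → A σ ≡ false → ¬ InI n t (insertF σ A)

Image : ∀ {n} → (Word n → Word n) → PermFam n → Word n → Set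
Image f A τ = ∃ λ σ → σ ∈ᶠ A × τ ≡ f σ

SameFam : ∀ {n} → (Word n → Set) → PermFam n → Set
SameFam P A = (∀ τ → P τ → τ ∈ᶠ A) × (∀ τ → τ ∈ᶠ A → P τ)

liftOp : ∀ {n} → (Word n → Word n) → PermFam n → Word n → Word n
liftOp op A σ = if A (op σ) then σ else op σ

-- Fixing.  If σ(i)=j:  i ↦ i, σ⁻¹(i) ↦ j (σ⁻¹(i) is the unique x with
-- σ(x)=i), other points unchanged.

fixOp : ∀ {n} → Fin n → Fin n → Word n → Word n
fixOp i j σ =
  if eqF (app σ i) j
  then tabulate (λ x → if eqF x i then i
                       else if eqF (app σ x) i then j
                       else app σ x)
  else σ

Fixed : ∀ {n} → PermFam n → Set
Fixed {n} A = ∀ (i j : Fin n) → i ≢ j → SameFam (Image (liftOp (fixOp i j) A) A) A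

-- Compression (i < j).  If σ(i)≠i and σ(j)=j: i ↦ i, j ↦ σ(i),
-- σ⁻¹(i) ↦ j, other points unchanged.

compOp : ∀ {n} → Fin n → Fin n → Word n → Word n
compOp i j σ =
  if eqF (app σ i) i ∨ not (eqF (app σ j) j)
  then σ
  else tabulate (λ x → if eqF x i then i
                       else if eqF x j then app σ i
                       else if eqF (app σ x) i then j
                       else app σ x)

Compressed : ∀ {n} → PermFam n → Set
Compressed {n} A =
  ∀ (i j : Fin n) → i F.< j → SameFam (Image (liftOp (compOp i j) A) A) A

Coll : ℕ → Set
Coll n = Subset n → Bool

fixSet : ∀ {n} → Word n → Subset n
fixSet σ = tabulate (λ x → eqF (app σ x) x)

InUp : ∀ {n} → Coll n → Word n → Set
InUp g σ = ∃ λ B → g B ≡ true × B ⊆ fixSet σ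

IsGenerating : ∀ {n} → PermFam n → Coll n → Set
IsGenerating {n} A g =
  (∀ B → g B ≡ true → Data.Fin.Subset.∣ B ∣ + 1 ≢ n)
  × (∀ σ → IsPerm σ → (InUp g σ → σ ∈ᶠ A) × (σ ∈ᶠ A → InUp g σ))
  where import Data.Fin.Subset

allSubsets : ∀ n → List (Subset n)
allSubsets zero    = [] ∷ []
allSubsets (suc n) =
  L.map (inside ∷_) (allSubsets n) L.++ L.map (outside ∷_) (allSubsets n)

elems : ∀ {n} → Subset n → List (Fin n)
elems []            = []
elems (true  ∷ bs)  = F.zero ∷ L.map F.suc (elems bs)
elems (false ∷ bs)  = L.map F.suc (elems bs)

termwiseLe : ∀ {n} → List (Fin n) → List (Fin n) → Bool
termwiseLe []       []       = true
termwiseLe (a ∷ as) (b ∷ bs) = leF a b ∧ termwiseLe as bs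
termwiseLe _        _        = false

inShift : ∀ {n} → Subset n → Subset n → Bool
inShift B A = termwiseLe (elems A) (elems B)

Lsh : ∀ {n} → Coll n → Coll n
Lsh {n} g A = anyᵇ (λ B → g B ∧ inShift B A) (allSubsets n)

subsetᵇ : ∀ {n} → Subset n → Subset n → Bool
subsetᵇ {n} C D = allᵇ (λ x → not (lookup C x) ∨ lookup D x) (allFin n)

psubsetᵇ : ∀ {n} → Subset n → Subset n → Bool
psubsetᵇ C D = subsetᵇ C D ∧ not (subsetᵇ D C)

Lstar : ∀ {n} → Coll n → Coll n
Lstar {n} g A =
  Lsh g A ∧ not (anyᵇ (λ C → Lsh g C ∧ psubsetᵇ C A) (allSubsets n))

-- s⁺ : largest element (elements of [n] = {1,…,n} are Fin n shifted by 1;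
-- conventionally 0 for the empty set / empty collection)

sPlus : ∀ {n} → Subset n → ℕ
sPlus B = L.foldr _⊔_ 0 (L.map (λ x → suc (toℕ x)) (elems B))

sPlusColl : ∀ {n} → Coll n → ℕ
sPlusColl {n} g =
  L.foldr _⊔_ 0 (L.map (λ B → if g B then sPlus B else 0) (allSubsets n))

module Submission where

-- (3) Every B ∈ 𝓛(g) contains a member of 𝓛*(g): if B is not minimal it has
--     a proper subset in 𝓛(g), which is smaller; recurse on |B|.
-- (2) If {a₁<…<a_k} is a left shift of {b₁<…<b_k} then a_k ≤ b_k, so the
--     largest element can only drop.
-- (1) A left shift has the size of the set it comes from, so no set of
--     𝓛*(g) has size n-1.  If σ ∈ A, σ fixes some B ∈ g, hence by (3) a set
--     of 𝓛*(g).  Conversely call S forcing if every permutation fixing S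
--     pointwise lies in A; the sets of g are forcing.  The compression step:
--     if S ∪ {b} is forcing, a < b and a ∉ S, then S ∪ {a} is forcing, since a
--     permutation τ fixing S ∪ {a} but not b is the (a,b)-compression of its
--     conjugate by the transposition (a b), which fixes S ∪ {b}.  Replacing
--     b₁,…,b_k by a₁,…,a_k from left to right (so a new point never collides
--     with the others) shows that every left shift of a set of g is forcing.

open import Defs
open import Data.Nat using (ℕ; _≤_)
open import Data.Bool using (true)
open import Data.Fin.Subset using (_⊆_)
open import Data.Product using (∃; _×_)
open import Relation.Binary.PropositionalEquality using (_≡_)

open import Data.Bool using (Bool; false; _∧_; _∨_; not; if_then_else_)
open import Data.Nat using (suc; z≤n; s≤s; _<_; _+_; _⊔_)
import Data.Nat.Properties as ℕP
open import Data.Nat.Induction using (<-wellFounded)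
open import Induction.WellFounded using (Acc; acc)
open import Data.Fin as F using (Fin; toℕ)
import Data.Fin.Properties as FP
open import Data.Fin.Permutation.Components using (transpose; transpose-inverse)
open import Data.Fin.Subset using (Subset; _∈_; _∉_; _⊂_; ∣_∣)
open import Data.Fin.Subset.Properties using (⊆-trans; p⊂q⇒p⊆q; p⊂q⇒∣p∣<∣q∣)
open import Data.Vec as V using (tabulate; lookup; _∷_)
open import Data.Vec.Properties using (lookup∘tabulate; tabulate∘lookup; tabulate-cong; []=⇒lookup; lookup⇒[]=)
open import Data.List as L using (List; []; _∷_; _++_; allFin)
import Data.List.Properties as LP
open import Data.List.Relation.Unary.All as All using (All; []; _∷_)
import Data.List.Relation.Unary.All.Properties as AllP
open import Data.List.Relation.Unary.AllPairs as AllPairs using (AllPairs; []; _∷_)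
import Data.List.Relation.Unary.AllPairs.Properties as AllPairsP
open import Data.List.Relation.Unary.Any using (here; there)
open import Data.List.Membership.Propositional using () renaming (_∈_ to _∈ˡ_)
open import Data.List.Membership.Propositional.Properties using (∈-allFin; ∈-map⁺; ∈-++⁺ˡ; ∈-++⁺ʳ)
open import Data.Product using (_,_; proj₁; proj₂)
open import Data.Sum using (_⊎_; inj₁; inj₂)
open import Data.Empty using (⊥-elim)
open import Function using (_∘_)
open import Relation.Nullary using (Dec; yes; no; does)
open import Relation.Nullary.Decidable using (dec-true; dec-false)
open import Relation.Binary.PropositionalEquality using (_≢_; refl; sym; trans; cong; cong₂; subst; module ≡-Reasoning)

∧-true : ∀ {a b} → a ∧ b ≡ true → a ≡ true × b ≡ true
∧-true {true} {true} _ = refl , refl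

not-true : ∀ {b} → not b ≡ true → b ≡ false
not-true {false} _ = refl

does-true : ∀ {P : Set} (d : Dec P) → does d ≡ true → P
does-true (yes p) _ = p

anyᵇ-witness : ∀ {X : Set} (p : X → Bool) xs → anyᵇ p xs ≡ true → ∃ λ x → x ∈ˡ xs × p x ≡ true
anyᵇ-witness p (x ∷ xs) e with p x in px
... | true = x , here refl , px
... | false with anyᵇ-witness p xs e
...   | y , y∈xs , py = y , there y∈xs , py

anyᵇ-intro : ∀ {X : Set} (p : X → Bool) {xs x} → x ∈ˡ xs → p x ≡ true → anyᵇ p xs ≡ true
anyᵇ-intro p (here refl) px rewrite px = refl
anyᵇ-intro p {y ∷ xs} (there x∈xs) px with p y
... | true = refl
... | false = anyᵇ-intro p x∈xs px

allᵇ-elim : ∀ {X : Set} (p : X → Bool) {xs x} → allᵇ p xs ≡ true → x ∈ˡ xs → p x ≡ true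
allᵇ-elim p e (here refl) = proj₁ (∧-true e)
allᵇ-elim p {y ∷ xs} e (there x∈xs) = allᵇ-elim p (proj₂ (∧-true {p y} e)) x∈xs

allᵇ-counterexample : ∀ {X : Set} (p : X → Bool) xs → allᵇ p xs ≡ false → ∃ λ x → x ∈ˡ xs × p x ≡ false
allᵇ-counterexample p (x ∷ xs) e with p x in px
... | false = x , here refl , px
... | true with allᵇ-counterexample p xs e
...   | y , y∈xs , py = y , there y∈xs , py

⊔-fold-upper : ∀ {x} xs → x ∈ˡ xs → x ≤ L.foldr _⊔_ 0 xs
⊔-fold-upper (y ∷ xs) (here refl) = ℕP.m≤m⊔n y _
⊔-fold-upper (y ∷ xs) (there x∈xs) = ℕP.≤-trans (⊔-fold-upper xs x∈xs) (ℕP.m≤n⊔m y _)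

⊔-fold-lub : ∀ {k} {xs : List ℕ} → All (_≤ k) xs → L.foldr _⊔_ 0 xs ≤ k
⊔-fold-lub [] = z≤n
⊔-fold-lub (x≤k ∷ xs≤k) = ℕP.⊔-lub x≤k (⊔-fold-lub xs≤k)

∈-lookup : ∀ {n} {x : Fin n} {C : Subset n} → x ∈ C → lookup C x ≡ true
∈-lookup = []=⇒lookup

lookup-∈ : ∀ {n} {x : Fin n} {C : Subset n} → lookup C x ≡ true → x ∈ C
lookup-∈ {x = x} {C} = lookup⇒[]= x C

lookup-∉ : ∀ {n} {x : Fin n} {C : Subset n} → lookup C x ≡ false → x ∉ C
lookup-∉ e x∈C with trans (sym (∈-lookup x∈C)) e
... | ()

elems⁺ : ∀ {n} {P : Fin n → Set} (C : Subset n) → (∀ {x} → x ∈ C → P x) → All P (elems C)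
elems⁺ V.[] h = []
elems⁺ (true ∷ C) h = h V.here ∷ AllP.map⁺ (elems⁺ C (h ∘ V.there))
elems⁺ (false ∷ C) h = AllP.map⁺ (elems⁺ C (h ∘ V.there))

elems⁻ : ∀ {n} {P : Fin n → Set} (C : Subset n) → All P (elems C) → ∀ {x} → x ∈ C → P x
elems⁻ (true ∷ C) (p ∷ ps) V.here = p
elems⁻ (true ∷ C) (p ∷ ps) (V.there x∈C) = elems⁻ C (AllP.map⁻ ps) x∈C
elems⁻ (false ∷ C) ps (V.there x∈C) = elems⁻ C (AllP.map⁻ ps) x∈C

elems-sorted : ∀ {n} (C : Subset n) → AllPairs F._<_ (elems C)
elems-sorted V.[] = []
elems-sorted (true ∷ C) =
  AllP.map⁺ (All.tabulate (λ _ → s≤s z≤n)) ∷ AllPairsP.map⁺ (AllPairs.map s≤s (elems-sorted C))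
elems-sorted (false ∷ C) = AllPairsP.map⁺ (AllPairs.map s≤s (elems-sorted C))

elems-length : ∀ {n} (C : Subset n) → ∣ C ∣ ≡ L.length (elems C)
elems-length V.[] = refl
elems-length (true ∷ C) = cong suc (trans (elems-length C) (sym (LP.length-map F.suc (elems C))))
elems-length (false ∷ C) = trans (elems-length C) (sym (LP.length-map F.suc (elems C)))

allSubsets-complete : ∀ {n} (C : Subset n) → C ∈ˡ allSubsets n
allSubsets-complete V.[] = here refl
allSubsets-complete (true ∷ C) = ∈-++⁺ˡ (∈-map⁺ (true ∷_) (allSubsets-complete C))
allSubsets-complete {suc n} (false ∷ C) =
  ∈-++⁺ʳ (L.map (true ∷_) (allSubsets n)) (∈-map⁺ (false ∷_) (allSubsets-complete C))

subsetᵇ-⊆ : ∀ {n} {C D : Subset n} → subsetᵇ C D ≡ true → C ⊆ D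
subsetᵇ-⊆ {C = C} {D} e {x} x∈C =
  lookup-∈ (subst (λ c → not c ∨ lookup D x ≡ true) (∈-lookup x∈C)
    (allᵇ-elim (λ y → not (lookup C y) ∨ lookup D y) e (∈-allFin x)))

subsetᵇ-⊈ : ∀ {n} {C D : Subset n} → subsetᵇ C D ≡ false → ∃ λ x → x ∈ C × x ∉ D
subsetᵇ-⊈ {n} {C} {D} e with allᵇ-counterexample (λ y → not (lookup C y) ∨ lookup D y) (allFin n) e
... | x , _ , px with lookup C x in cx | lookup D x in dx
...   | true | false = x , lookup-∈ cx , lookup-∉ dx

psubsetᵇ-⊂ : ∀ {n} {C D : Subset n} → psubsetᵇ C D ≡ true → C ⊂ D
psubsetᵇ-⊂ {C = C} {D} e with ∧-true {subsetᵇ C D} e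
... | C⊆D , D⊈C = subsetᵇ-⊆ {C = C} {D} C⊆D , subsetᵇ-⊈ {C = D} {C} (not-true D⊈C)

Fixes : ∀ {n} → Word n → Fin n → Set
Fixes σ x = app σ x ≡ x

fixSet-fixes : ∀ {n} {σ : Word n} {x} → x ∈ fixSet σ → Fixes σ x
fixSet-fixes {σ = σ} {x} x∈ =
  does-true (app σ x F.≟ x) (trans (sym (lookup∘tabulate _ x)) (∈-lookup x∈))

fixes-fixSet : ∀ {n} {σ : Word n} {x} → Fixes σ x → x ∈ fixSet σ
fixes-fixSet {σ = σ} {x} σx≡x =
  lookup-∈ (trans (lookup∘tabulate _ x) (dec-true (app σ x F.≟ x) σx≡x))

termwise-refl : ∀ {n} (xs : List (Fin n)) → termwiseLe xs xs ≡ true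
termwise-refl [] = refl
termwise-refl (x ∷ xs) rewrite dec-true (x F.≤? x) FP.≤-refl = termwise-refl xs

termwise-length : ∀ {n} (as bs : List (Fin n)) → termwiseLe as bs ≡ true → L.length as ≡ L.length bs
termwise-length [] [] _ = refl
termwise-length (a ∷ as) (b ∷ bs) e = cong suc (termwise-length as bs (proj₂ (∧-true {leF a b} e)))

shift-size : ∀ {n} {B C : Subset n} → inShift B C ≡ true → ∣ C ∣ ≡ ∣ B ∣
shift-size {B = B} {C} C≼B = begin
  ∣ C ∣                  ≡⟨ elems-length C ⟩
  L.length (elems C)     ≡⟨ termwise-length (elems C) (elems B) C≼B ⟩
  L.length (elems B)     ≡⟨ sym (elems-length B) ⟩
  ∣ B ∣                  ∎
  where open ≡-Reasoning

termwise-max : ∀ {n} (as bs : List (Fin n)) → termwiseLe as bs ≡ true →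
  L.foldr _⊔_ 0 (L.map (λ x → suc (toℕ x)) as) ≤ L.foldr _⊔_ 0 (L.map (λ x → suc (toℕ x)) bs)
termwise-max [] [] _ = z≤n
termwise-max (a ∷ as) (b ∷ bs) e with ∧-true {leF a b} e
... | a≤b , rest = ℕP.⊔-mono-≤ (s≤s (does-true (a F.≤? b) a≤b)) (termwise-max as bs rest)

module LeftShifts {n : ℕ} (g : Coll n) where

  Lsh-generator : ∀ {C} → Lsh g C ≡ true → ∃ λ B → g B ≡ true × inShift B C ≡ true
  Lsh-generator {C} e with anyᵇ-witness (λ B → g B ∧ inShift B C) (allSubsets n) e
  ... | B , _ , q = B , ∧-true {g B} q

  generator-Lsh : ∀ {B} → g B ≡ true → Lsh g B ≡ true
  generator-Lsh {B} gB =
    anyᵇ-intro (λ B' → g B' ∧ inShift B' B) (allSubsets-complete B) (cong₂ _∧_ gB (termwise-refl (elems B)))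

  Lstar-Lsh : ∀ {C} → Lstar g C ≡ true → Lsh g C ≡ true
  Lstar-Lsh {C} e = proj₁ (∧-true {Lsh g C} e)

  Lstar-or-smaller : ∀ {B} → Lsh g B ≡ true → Lstar g B ≡ true ⊎ ∃ λ C → Lsh g C ≡ true × C ⊂ B
  Lstar-or-smaller {B} hB with anyᵇ (λ C → Lsh g C ∧ psubsetᵇ C B) (allSubsets n) in e
  ... | false = inj₁ (cong (_∧ true) hB)
  ... | true with anyᵇ-witness (λ C → Lsh g C ∧ psubsetᵇ C B) (allSubsets n) e
  ...   | C , _ , q with ∧-true {Lsh g C} q
  ...     | hC , C⊂B = inj₂ (C , hC , psubsetᵇ-⊂ C⊂B)

  minimal-below-acc : ∀ B → Acc _<_ ∣ B ∣ → Lsh g B ≡ true → ∃ λ C → C ⊆ B × Lstar g C ≡ true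
  minimal-below-acc B (acc smaller) hB with Lstar-or-smaller hB
  ... | inj₁ minimal = B , (λ x∈B → x∈B) , minimal
  ... | inj₂ (C , hC , C⊂B) with minimal-below-acc C (smaller (p⊂q⇒∣p∣<∣q∣ C⊂B)) hC
  ...   | D , D⊆C , hD = D , ⊆-trans D⊆C (p⊂q⇒p⊆q C⊂B) , hD

  minimal-below : ∀ B → Lsh g B ≡ true → ∃ λ C → C ⊆ B × Lstar g C ≡ true
  minimal-below B = minimal-below-acc B (<-wellFounded ∣ B ∣)

  Lstar-sizes : (∀ B → g B ≡ true → ∣ B ∣ + 1 ≢ n) → ∀ C → Lstar g C ≡ true → ∣ C ∣ + 1 ≢ n
  Lstar-sizes sizes C hC with Lsh-generator {C} (Lstar-Lsh {C} hC)
  ... | B , gB , C≼B = subst (λ k → k + 1 ≢ n) (sym (shift-size {B = B} {C} C≼B)) (sizes B gB)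

  sPlus-Lstar : sPlusColl (Lstar g) ≤ sPlusColl g
  sPlus-Lstar = ⊔-fold-lub (AllP.map⁺ {xs = allSubsets n} (All.tabulate (λ {C} _ → bound C)))
    where
    bound : ∀ C → (if Lstar g C then sPlus C else 0) ≤ sPlusColl g
    bound C with Lstar g C in e
    ... | false = z≤n
    ... | true with Lsh-generator {C} (Lstar-Lsh {C} e)
    ...   | B , gB , C≼B = ℕP.≤-trans (termwise-max (elems C) (elems B) C≼B)
        (subst (_≤ sPlusColl g) (cong (λ b → if b then sPlus B else 0) gB)
          (⊔-fold-upper _ (∈-map⁺ (λ B' → if g B' then sPlus B' else 0) (allSubsets-complete B))))

transpose-matchˡ : ∀ {n} (i j : Fin n) → transpose i j i ≡ j
transpose-matchˡ i j with i F.≟ i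
... | yes _ = refl
... | no i≢i = ⊥-elim (i≢i refl)

transpose-matchʳ : ∀ {n} (i j : Fin n) → transpose i j j ≡ i
transpose-matchʳ i j with j F.≟ i
... | yes j≡i = j≡i
... | no _ with j F.≟ j
...   | yes _ = refl
...   | no j≢j = ⊥-elim (j≢j refl)

transpose-other : ∀ {n} {i j k : Fin n} → k ≢ i → k ≢ j → transpose i j k ≡ k
transpose-other {i = i} {j} {k} k≢i k≢j with k F.≟ i
... | yes k≡i = ⊥-elim (k≢i k≡i)
... | no _ with k F.≟ j
...   | yes k≡j = ⊥-elim (k≢j k≡j)
...   | no _ = refl

transpose-injective : ∀ {n} (i j : Fin n) {x y} → transpose i j x ≡ transpose i j y → x ≡ y
transpose-injective i j {x} {y} e = begin
  x                                 ≡⟨ sym (transpose-inverse j i) ⟩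
  transpose j i (transpose i j x)   ≡⟨ cong (transpose j i) e ⟩
  transpose j i (transpose i j y)   ≡⟨ transpose-inverse j i ⟩
  y                                 ∎
  where open ≡-Reasoning

compOp-active : ∀ {n} (i j : Fin n) (σ : Word n) → app σ i ≢ i → Fixes σ j →
  compOp i j σ ≡ tabulate (λ x → if eqF x i then i
                                 else if eqF x j then app σ i
                                 else if eqF (app σ x) i then j
                                 else app σ x)
compOp-active i j σ σi≢i σj≡j
  rewrite dec-false (app σ i F.≟ i) σi≢i | dec-true (app σ j F.≟ j) σj≡j = refl

-- Conjugating a permutation τ that fixes a but moves b by the transposition
-- (a b) gives a permutation σ fixing b whose (a,b)-compression is τ.
module Conjugate {n : ℕ} (τ : Word n) (τ-perm : IsPerm τ) {a b : Fin n}
                 (a≢b : a ≢ b) (τa≡a : Fixes τ a) (τb≢b : app τ b ≢ b) where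

  open ≡-Reasoning

  s : Fin n → Fin n
  s = transpose a b

  σ : Word n
  σ = tabulate (λ x → s (app τ (s x)))

  σ-app : ∀ x → app σ x ≡ s (app τ (s x))
  σ-app = lookup∘tabulate (λ x → s (app τ (s x)))

  σ-perm : IsPerm σ
  σ-perm x y e = transpose-injective a b
    (τ-perm _ _ (transpose-injective a b (trans (sym (σ-app x)) (trans e (σ-app y)))))

  τ-avoids-a : ∀ {x} → x ≢ a → app τ x ≢ a
  τ-avoids-a x≢a e = x≢a (τ-perm _ _ (trans e (sym τa≡a)))

  b≢a : b ≢ a
  b≢a = a≢b ∘ sym

  σ-other : ∀ {x} → x ≢ a → x ≢ b → app σ x ≡ s (app τ x)
  σ-other {x} x≢a x≢b = trans (σ-app x) (cong (s ∘ app τ) (transpose-other x≢a x≢b))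

  σb≡b : Fixes σ b
  σb≡b = begin
    app σ b          ≡⟨ σ-app b ⟩
    s (app τ (s b))  ≡⟨ cong (s ∘ app τ) (transpose-matchʳ a b) ⟩
    s (app τ a)      ≡⟨ cong s τa≡a ⟩
    s a              ≡⟨ transpose-matchˡ a b ⟩
    b                ∎

  σa≡τb : app σ a ≡ app τ b
  σa≡τb = begin
    app σ a          ≡⟨ σ-app a ⟩
    s (app τ (s a))  ≡⟨ cong (s ∘ app τ) (transpose-matchˡ a b) ⟩
    s (app τ b)      ≡⟨ transpose-other (τ-avoids-a b≢a) τb≢b ⟩
    app τ b          ∎

  σ-fixes : ∀ {x} → x ≢ a → Fixes τ x → Fixes σ x
  σ-fixes {x} x≢a τx≡x = begin
    app σ x      ≡⟨ σ-other x≢a x≢b ⟩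
    s (app τ x)  ≡⟨ cong s τx≡x ⟩
    s x          ≡⟨ transpose-other x≢a x≢b ⟩
    x            ∎
    where
    x≢b : x ≢ b
    x≢b refl = τb≢b τx≡x

  compressed-point : ∀ x → (if eqF x a then a
                            else if eqF x b then app σ a
                            else if eqF (app σ x) a then b
                            else app σ x) ≡ app τ x
  compressed-point x with x F.≟ a
  ... | yes refl = sym τa≡a
  ... | no x≢a with x F.≟ b
  ...   | yes refl = σa≡τb
  ...   | no x≢b with app σ x F.≟ a
  ...     | yes σx≡a = sym (transpose-injective a b
                          (trans (sym (σ-other x≢a x≢b)) (trans σx≡a (sym (transpose-matchʳ a b)))))
  ...     | no σx≢a = trans (σ-other x≢a x≢b) (transpose-other (τ-avoids-a x≢a) τx≢b)
    where
    τx≢b : app τ x ≢ b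
    τx≢b τx≡b = σx≢a (trans (σ-other x≢a x≢b) (trans (cong s τx≡b) (transpose-matchʳ a b)))

  compOp-σ : compOp a b σ ≡ τ
  compOp-σ = begin
    compOp a b σ             ≡⟨ compOp-active a b σ σa≢a σb≡b ⟩
    tabulate _               ≡⟨ tabulate-cong compressed-point ⟩
    tabulate (lookup τ)      ≡⟨ tabulate∘lookup τ ⟩
    τ                        ∎
    where
    σa≢a : app σ a ≢ a
    σa≢a e = τ-avoids-a b≢a (trans (sym σa≡τb) e)

module Compression {n : ℕ} (A : PermFam n) (compressed : Compressed A) where

  compress-closed : ∀ {i j} → i F.< j → ∀ {σ} → σ ∈ᶠ A → compOp i j σ ∈ᶠ A
  compress-closed {i} {j} i<j {σ} σ∈A with A (compOp i j σ) in e
  ... | true = refl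
  ... | false = trans (sym e) (proj₁ (compressed i j i<j) (compOp i j σ) (σ , σ∈A , image))
    where
    image : compOp i j σ ≡ liftOp (compOp i j) A σ
    image = cong (λ c → if c then σ else compOp i j σ) (sym e)

  Forcing : List (Fin n) → Set
  Forcing S = ∀ τ → IsPerm τ → All (Fixes τ) S → τ ∈ᶠ A

  replace-point : ∀ xs ys {a b} → a F.< b → All (_≢ a) xs → All (_≢ a) ys →
    Forcing (xs ++ b ∷ ys) → Forcing (xs ++ a ∷ ys)
  replace-point xs ys {a} {b} a<b xs≢a ys≢a forcing τ τ-perm τ-fixes with AllP.++⁻ xs τ-fixes
  ... | fix-xs , τa≡a ∷ fix-ys with app τ b F.≟ b
  ...   | yes τb≡b = forcing τ τ-perm (AllP.++⁺ fix-xs (τb≡b ∷ fix-ys))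
  ...   | no τb≢b = subst (_∈ᶠ A) compOp-σ (compress-closed a<b σ∈A)
    where
    open Conjugate τ τ-perm (FP.<⇒≢ a<b) τa≡a τb≢b
    σ-fixes-all : ∀ {zs} → All (_≢ a) zs → All (Fixes τ) zs → All (Fixes σ) zs
    σ-fixes-all zs≢a fix-zs = All.zipWith (λ (z≢a , τz≡z) → σ-fixes z≢a τz≡z) (zs≢a , fix-zs)
    σ∈A : σ ∈ᶠ A
    σ∈A = forcing σ σ-perm (AllP.++⁺ (σ-fixes-all xs≢a fix-xs) (σb≡b ∷ σ-fixes-all ys≢a fix-ys))

  -- The points b₁ < b₂ < … are
  -- replaced by a₁ < a₂ < … from left to right; `pre` holds the points already
  -- replaced, which all lie below the bound m ≤ the remaining aᵢ.
  shift-forcing : ∀ m pre as bs → All (λ x → toℕ x < m) pre → All (λ y → m ≤ toℕ y) as →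
    AllPairs F._<_ as → AllPairs F._<_ bs → termwiseLe as bs ≡ true →
    Forcing (pre ++ bs) → Forcing (pre ++ as)
  shift-forcing m pre [] [] _ _ _ _ _ forcing = forcing
  shift-forcing m pre (a ∷ as) (b ∷ bs) pre<m (m≤a ∷ _) (a<as ∷ as↑) (b<bs ∷ bs↑) e forcing
    with ∧-true {leF a b} e
  ... | a≤ᵇb , as≼bs =
    subst Forcing (LP.++-assoc pre (a ∷ []) as)
      (shift-forcing (suc (toℕ a)) (pre ++ a ∷ []) as bs pre+a<a+1 a<as as↑ bs↑ as≼bs
        (subst Forcing (sym (LP.++-assoc pre (a ∷ []) bs)) forcing-a))
    where
    a≤b : a F.≤ b
    a≤b = does-true (a F.≤? b) a≤ᵇb
    pre+a<a+1 : All (λ x → toℕ x < suc (toℕ a)) (pre ++ a ∷ [])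
    pre+a<a+1 = AllP.++⁺ (All.map (λ x<m → ℕP.m≤n⇒m≤1+n (ℕP.≤-trans x<m m≤a)) pre<m) (ℕP.≤-refl ∷ [])
    forcing-a : Forcing (pre ++ a ∷ bs)
    forcing-a with a F.≟ b
    ... | yes refl = forcing
    ... | no a≢b = replace-point pre bs (FP.≤∧≢⇒< a≤b a≢b)
      (All.map (λ x<m x≡a → ℕP.<-irrefl (cong toℕ x≡a) (ℕP.<-≤-trans x<m m≤a)) pre<m)
      (All.map (λ b<y y≡a → ℕP.<-irrefl (cong toℕ (sym y≡a)) (ℕP.≤-<-trans a≤b b<y)) b<bs)
      forcing
  shift-forcing m pre [] (b ∷ bs) _ _ _ _ () _
  shift-forcing m pre (a ∷ as) [] _ _ _ _ () _

Generates : ∀ {n} → PermFam n → Coll n → Set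
Generates A g = ∀ σ → IsPerm σ → (InUp g σ → σ ∈ᶠ A) × (σ ∈ᶠ A → InUp g σ)

module Generation {n : ℕ} (A : PermFam n) (compressed : Compressed A)
                  (g : Coll n) (generates : Generates A g) where

  open LeftShifts g
  open Compression A compressed

  generator-forcing : ∀ {B} → g B ≡ true → Forcing (elems B)
  generator-forcing {B} gB τ τ-perm τ-fixes =
    proj₁ (generates τ τ-perm) (B , gB , λ x∈B → fixes-fixSet {σ = τ} (elems⁻ B τ-fixes x∈B))

  Lsh-forcing : ∀ {C} → Lsh g C ≡ true → Forcing (elems C)
  Lsh-forcing {C} hC with Lsh-generator {C} hC
  ... | B , gB , C≼B =
    shift-forcing 0 [] (elems C) (elems B) [] (All.tabulate (λ _ → z≤n))
      (elems-sorted C) (elems-sorted B) C≼B (generator-forcing gB)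

  Lstar-generates : Generates A (Lstar g)
  Lstar-generates σ σ-perm = sound , complete
    where
    sound : InUp (Lstar g) σ → σ ∈ᶠ A
    sound (C , hC , C⊆fix) =
      Lsh-forcing {C} (Lstar-Lsh {C} hC) σ σ-perm (elems⁺ C (λ x∈C → fixSet-fixes {σ = σ} (C⊆fix x∈C)))
    complete : σ ∈ᶠ A → InUp (Lstar g) σ
    complete σ∈A with proj₂ (generates σ σ-perm) σ∈A
    ... | B , gB , B⊆fix with minimal-below B (generator-Lsh gB)
    ...   | C , C⊆B , hC = C , hC , λ x∈C → B⊆fix (C⊆B x∈C)

lemma2p12 : (n t : ℕ) → 1 ≤ t → (A : PermFam n) →
    InI n t A → Maximal n t A → Fixed A → Compressed A →
    (g : Coll n) → IsGenerating A g →
    IsGenerating A (Lstar g)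
    × sPlusColl (Lstar g) ≤ sPlusColl g
    × (∀ B → Lsh g B ≡ true → ∃ λ C → C ⊆ B × Lstar g C ≡ true)
lemma2p12 _ _ _ A _ _ _ compressed g (sizes , generates) =
  (Lstar-sizes sizes , Lstar-generates) , sPlus-Lstar , minimal-below
  where
  open LeftShifts g
  open Generation A compressed g generates
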